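{- Let $\Delta\geq 3$. Let $Q_\Delta$ be the $\Delta$-dimensional hypercube, fix an edge $xy\in E(Q_\Delta)$, and let $Q_\Delta^+$ be the graph with vertex set $V(Q_\Delta)\cup\{x',y'\}$ (where $x',y'$ are two new vertices) and edge set $(E(Q_\Delta)\setminus\{xy\})\cup\{xx',yy'\}$. Then: (1) If $\alpha$ is a proper edge colouring of $Q_\Delta^+$ with colours in $[\Delta]=\{1,\dots,\Delta\}$, then $\alpha(xx')=\alpha(yy')$. (2) For every $i\in[\Delta]$, if $xx'$ is precoloured with colour $i$, then there is an ordering $e_1,\dots,e_m$ of the remaining edges $E(Q_\Delta^+)\setminus\{xx'\}$ such that each $e_j$ shares an endpoint with $xx'$ or with some $e_{j'}$, $j'<j$, and such that the greedy procedure (assigning to $e_j$, for $j=1,\dots,m$, the smallest positive integer not already used on $xx'$ or on an earlier $e_{j'}$ sharing an endpoint with $e_j$) uses only colours in $[\Delta]$.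
   Context: The $\Delta$-dimensional hypercube $Q_\Delta$ has vertex set $\{0,1\}^\Delta$, two vertices adjacent iff they differ in exactly one coordinate. A proper edge colouring assigns colours to edges so that edges sharing an endpoint get different colours. -}

module Defs where

open import Data.Bool using (Bool; true; false; not; _∧_; _∨_; T; if_then_else_)
import Data.Bool.Properties as BoolP
open import Data.Nat using (ℕ; zero; suc; _≤_; _≡ᵇ_)
open import Data.Fin using (Fin)
import Data.Fin.Properties as FinP
open import Data.Vec using (Vec; lookup; _[_]%=_)
import Data.Vec.Properties as VecP
open import Data.List using (List; []; _∷_; map; filterᵇ; length)
open import Data.Bool.ListAction using (any)
open import Data.List.Relation.Unary.Any using (Any)
open import Data.Product using (_×_; _,_; proj₁; proj₂)
open import Data.Unit using (⊤)
open import Relation.Nullary.Decidable using (⌊_⌋)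

Cube : ℕ → Set
Cube Δ = Vec Bool Δ

flip : ∀ {Δ} → Cube Δ → Fin Δ → Cube Δ
flip v i = v [ i ]%= not

_≟V_ : ∀ {Δ} → (u v : Cube Δ) → _
_≟V_ = VecP.≡-dec BoolP._≟_

-- A cube edge {v, flip v i} is represented canonically by the endpoint v with
-- v_i = 0 (false) together with the direction i.
-- The fixed edge xy is {x, flip x d}.  isXY x d v i : does the edge (v,i) equal xy?
isXY : ∀ {Δ} → Cube Δ → Fin Δ → Cube Δ → Fin Δ → Bool
isXY x d v i = ⌊ FinP._≟_ i d ⌋ ∧ (⌊ v ≟V x ⌋ ∨ ⌊ v ≟V flip x d ⌋)

data V⁺ (Δ : ℕ) : Set where
  old : Cube Δ → V⁺ Δ
  x′  : V⁺ Δ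
  y′  : V⁺ Δ

eqV⁺ : ∀ {Δ} → V⁺ Δ → V⁺ Δ → Bool
eqV⁺ (old u) (old v) = ⌊ u ≟V v ⌋
eqV⁺ x′ x′ = true
eqV⁺ y′ y′ = true
eqV⁺ _ _ = false

data Edge⁺ {Δ : ℕ} (x : Cube Δ) (d : Fin Δ) : Set where
  cube : (v : Cube Δ) (i : Fin Δ) → T (not (lookup v i)) → T (not (isXY x d v i)) → Edge⁺ x d
  xx′  : Edge⁺ x d
  yy′  : Edge⁺ x d

ends : ∀ {Δ} {x : Cube Δ} {d : Fin Δ} → Edge⁺ x d → V⁺ Δ × V⁺ Δ
ends (cube v i _ _) = old v , old (flip v i)
ends {x = x} xx′ = old x , x′
ends {x = x} {d} yy′ = old (flip x d) , y′

shareB : ∀ {Δ} {x : Cube Δ} {d : Fin Δ} → Edge⁺ x d → Edge⁺ x d → Bool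
shareB e f with ends e | ends f
... | a , b | c , d' = eqV⁺ a c ∨ eqV⁺ a d' ∨ eqV⁺ b c ∨ eqV⁺ b d'

Share : ∀ {Δ} {x : Cube Δ} {d : Fin Δ} → Edge⁺ x d → Edge⁺ x d → Set
Share e f = T (shareB e f)

open import Relation.Binary.PropositionalEquality using (_≡_; _≢_)

Proper : ∀ {Δ} {x : Cube Δ} {d : Fin Δ} {C : Set} → (Edge⁺ x d → C) → Set
Proper {x = x} {d} α = ∀ (e f : Edge⁺ x d) → e ≢ f → Share e f → α e ≢ α f

-- smallest positive integer not in a list: search k = 1,2,...; fuel (length+1)
-- always suffices by pigeonhole, so the fallback value is never reached.
firstFreeFrom : ℕ → ℕ → List ℕ → ℕ
firstFreeFrom zero k used = k
firstFreeFrom (suc fuel) k used =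
  if any (λ c → c ≡ᵇ k) used then firstFreeFrom fuel (suc k) used else k

firstFree : List ℕ → ℕ
firstFree used = firstFreeFrom (suc (length used)) 1 used

greedy : ∀ {Δ} {x : Cube Δ} {d : Fin Δ} →
         List (Edge⁺ x d × ℕ) → List (Edge⁺ x d) → List (Edge⁺ x d × ℕ)
greedy acc [] = acc
greedy acc (e ∷ es) =
  greedy ((e , firstFree (map proj₂ (filterᵇ (λ p → shareB (proj₁ p) e) acc))) ∷ acc) es

Conn : ∀ {Δ} {x : Cube Δ} {d : Fin Δ} → List (Edge⁺ x d) → List (Edge⁺ x d) → Set
Conn seen [] = ⊤
Conn seen (e ∷ es) = Any (λ f → Share f e) seen × Conn (e ∷ seen) es

-- (1) At a cube vertex the Δ edges carry Δ distinct colours, so every colour occurs there. If xx′ and yy′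
-- had different colours, the other edges coloured like xx′ would form a perfect matching of Q_Δ − x,
-- which has the odd number 2^Δ − 1 of vertices.
-- (2) Colouring every edge by its direction (permuted so that xx′ gets colour i) is a proper Δ-colouring.
-- Rank cube vertices by their distance from x, with the vertices on y's side of direction d coming after,
-- ranked by their distance from a neighbour b′ of y. List the edges by the rank of their lower endpoint and
-- then by colour. An edge then sees all smaller colours on earlier edges at its lower endpoint, so the
-- greedy procedure reproduces the direction colouring; and since every vertex other than x has a neighbour
-- of smaller rank, every edge meets an earlier one.

module Submission where

open import Defs
open import Data.Bool using (Bool; true; false; not; T; _∨_; _xor_; if_then_else_)
import Data.Bool.Properties as Boolₚ
open import Data.Bool.ListAction using (any)
open import Data.Empty using (⊥; ⊥-elim)
open import Data.Fin using (Fin; zero; suc; toℕ; fromℕ<; punchOut; _↑ˡ_; _↑ʳ_; splitAt)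
import Data.Fin.Properties as Finₚ
open import Data.Fin.Permutation.Components using (transpose; transpose-inverse)
open import Data.Nat using (ℕ; zero; suc; _≤_; _<_; _+_; _*_; _^_; _⊓_; z≤n; s≤s; _≡ᵇ_; _≟_)
import Data.Nat.Properties as ℕₚ
open import Data.List using (List; []; _∷_; _++_; _ʳ++_; map; filter; filterᵇ; concatMap; allFin; deduplicate; length)
open import Data.List.Relation.Unary.Any using (Any; here; there; index)
import Data.List.Relation.Unary.Any as Any
import Data.List.Relation.Unary.Any.Properties as Anyₚ
open import Data.List.Relation.Unary.All using (All)
import Data.List.Relation.Unary.All as All
import Data.List.Relation.Unary.All.Properties as Allₚ
open import Data.List.Relation.Unary.AllPairs using ([]; _∷_)
open import Data.List.Relation.Unary.Unique.Propositional using (Unique)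
import Data.List.Relation.Unary.Unique.Propositional.Properties as Uniqueₚ
import Data.List.Relation.Unary.Unique.DecPropositional.Properties as DecUniqueₚ
open import Data.List.Relation.Binary.Subset.Propositional using (_⊆_)
open import Data.List.Membership.Propositional using (_∈_; _∉_)
open import Data.List.Membership.Propositional.Properties
  using (∈-map⁺; ∈-map⁻; ∈-filter⁺; ∈-filter⁻; ∈-++⁺ˡ; ∈-++⁺ʳ; ∈-++⁻; ∈-concatMap⁺; ∈-allFin; ∈-deduplicate⁺; ∈-deduplicate⁻)
import Data.List.Membership.Setoid.Properties as SetoidMembershipₚ
open import Data.Product using (_×_; _,_; proj₁; proj₂; ∃)
open import Data.Sum using (_⊎_; inj₁; inj₂)
import Data.Sum as Sum
open import Data.Unit using (⊤; tt)
open import Data.Vec using ([]; _∷_; lookup; _[_]≔_)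
import Data.Vec.Properties as Vecₚ
open import Function using (_∘_)
open import Function.Bundles using (Equivalence)
open import Function.Definitions using (Injective)
open import Relation.Nullary using (¬_; Dec; yes; no; ¬?)
open import Relation.Nullary.Decidable using (T?; toWitness; fromWitness)
open import Relation.Binary.Definitions using (DecidableEquality)
open import Relation.Binary.PropositionalEquality

orˡ : ∀ a {b} → T a → T (a ∨ b)
orˡ a = Equivalence.from (Boolₚ.T-∨ {a}) ∘ inj₁

orʳ : ∀ a {b} → T b → T (a ∨ b)
orʳ a = Equivalence.from (Boolₚ.T-∨ {a}) ∘ inj₂

or-elim : ∀ a {b} → T (a ∨ b) → T a ⊎ T b
or-elim a = Equivalence.to (Boolₚ.T-∨ {a})

injective⇒surjective : ∀ {n} (f : Fin n → Fin n) → Injective _≡_ _≡_ f → ∀ c → ∃ λ j → f j ≡ c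
injective⇒surjective {zero} f inj ()
injective⇒surjective {suc n} f inj c with Finₚ.any? (λ j → f j Finₚ.≟ c)
... | yes hit = hit
... | no miss = ⊥-elim (ℕₚ.1+n≰n (Finₚ.injective⇒≤ f′-injective))
  where
  f′ : Fin (suc n) → Fin n
  f′ j = punchOut (λ c≡fj → miss (j , sym c≡fj))
  f′-injective : Injective _≡_ _≡_ f′
  f′-injective = inj ∘ Finₚ.punchOut-injective {i = c} _ _

another-direction : ∀ {n} → 2 ≤ n → (d : Fin n) → ∃ λ j → j ≢ d
another-direction (s≤s (s≤s _)) zero = suc zero , λ ()
another-direction (s≤s (s≤s _)) (suc _) = zero , λ ()

colour-index : ∀ {n} i → 1 ≤ i → i ≤ n → ∃ λ (t : Fin n) → suc (toℕ t) ≡ i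
colour-index (suc i) _ i<n = fromℕ< i<n , cong suc (Finₚ.toℕ-fromℕ< i<n)

module _ {n : ℕ} where

  lookup-flip : (v : Cube n) (i : Fin n) → lookup (flip v i) i ≡ not (lookup v i)
  lookup-flip v i = Vecₚ.lookup∘updateAt i v

  lookup-flip-≢ : (v : Cube n) {i j : Fin n} → j ≢ i → lookup (flip v i) j ≡ lookup v j
  lookup-flip-≢ v {i} {j} j≢i = Vecₚ.lookup∘updateAt′ j i j≢i v

  flip-involutive : (v : Cube n) (i : Fin n) → flip (flip v i) i ≡ v
  flip-involutive v i =
    trans (Vecₚ.updateAt-updateAt i v) (Vecₚ.updateAt-id-local i v (Boolₚ.not-involutive (lookup v i)))

  flip-injective : ∀ {u v : Cube n} i → flip u i ≡ flip v i → u ≡ v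
  flip-injective {u} {v} i eq = begin
    u                   ≡⟨ flip-involutive u i ⟨
    flip (flip u i) i   ≡⟨ cong (λ w → flip w i) eq ⟩
    flip (flip v i) i   ≡⟨ flip-involutive v i ⟩
    v                   ∎
    where open ≡-Reasoning

  lookup-not⇒≢ : ∀ {u v : Cube n} i → lookup u i ≡ not (lookup v i) → u ≢ v
  lookup-not⇒≢ {v = v} i eq refl = Boolₚ.not-¬ refl eq

  flip-≢ : (v : Cube n) (i : Fin n) → flip v i ≢ v
  flip-≢ v i = lookup-not⇒≢ i (lookup-flip v i)

≢⇒lookup-≢ : ∀ {n} (u v : Cube n) → u ≢ v → ∃ λ i → lookup u i ≢ lookup v i
≢⇒lookup-≢ [] [] u≢v = ⊥-elim (u≢v refl)
≢⇒lookup-≢ (a ∷ u) (b ∷ v) u≢v with a Boolₚ.≟ b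
... | no a≢b = zero , a≢b
... | yes refl with ≢⇒lookup-≢ u v (u≢v ∘ cong (a ∷_))
...   | i , neq = suc i , neq

dist : ∀ {n} → Cube n → Cube n → ℕ
dist [] [] = 0
dist (a ∷ u) (b ∷ v) = if a xor b then suc (dist u v) else dist u v

dist≤dim : ∀ {n} (u v : Cube n) → dist u v ≤ n
dist≤dim [] [] = z≤n
dist≤dim (a ∷ u) (b ∷ v) with a xor b
... | true = s≤s (dist≤dim u v)
... | false = ℕₚ.m≤n⇒m≤1+n (dist≤dim u v)

dist-flip : ∀ {n} (u v : Cube n) j → lookup u j ≢ lookup v j → suc (dist (flip u j) v) ≡ dist u v
dist-flip (false ∷ u) (false ∷ v) zero ne = ⊥-elim (ne refl)
dist-flip (false ∷ u) (true ∷ v) zero ne = refl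
dist-flip (true ∷ u) (false ∷ v) zero ne = refl
dist-flip (true ∷ u) (true ∷ v) zero ne = ⊥-elim (ne refl)
dist-flip (a ∷ u) (b ∷ v) (suc j) ne with a xor b
... | true = cong suc (dist-flip u v j ne)
... | false = dist-flip u v j ne

parity : ∀ {n} → Cube n → Bool
parity [] = false
parity (a ∷ v) = a xor parity v

parity-flip : ∀ {n} (v : Cube n) i → parity (flip v i) ≡ not (parity v)
parity-flip (a ∷ v) zero = sym (Boolₚ.not-distribˡ-xor a (parity v))
parity-flip (a ∷ v) (suc i) = trans (cong (a xor_) (parity-flip v i)) (sym (Boolₚ.not-distribʳ-xor a (parity v)))

-- Fin (2 ^ suc n) computes to Fin (2 ^ n + (2 ^ n + 0))
toFin : ∀ {n} → Cube n → Fin (2 ^ n)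
toFin [] = zero
toFin {suc n} (false ∷ v) = toFin v ↑ˡ (2 ^ n + 0)
toFin {suc n} (true ∷ v) = (2 ^ n) ↑ʳ (toFin v ↑ˡ 0)

fromFin : ∀ {n} → Fin (2 ^ n) → Cube n
fromFin {zero} _ = []
fromFin {suc n} k with splitAt (2 ^ n) k
... | inj₁ k′ = false ∷ fromFin k′
... | inj₂ k′ with splitAt (2 ^ n) {0} k′
...   | inj₁ k″ = true ∷ fromFin k″

fromFin∘toFin : ∀ {n} (v : Cube n) → fromFin (toFin v) ≡ v
fromFin∘toFin [] = refl
fromFin∘toFin {suc n} (false ∷ v)
  rewrite Finₚ.splitAt-↑ˡ (2 ^ n) (toFin v) (2 ^ n + 0) = cong (false ∷_) (fromFin∘toFin v)
fromFin∘toFin {suc n} (true ∷ v)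
  rewrite Finₚ.splitAt-↑ʳ (2 ^ n) (2 ^ n + 0) (toFin v ↑ˡ 0)
        | Finₚ.splitAt-↑ˡ (2 ^ n) (toFin v) 0 = cong (true ∷_) (fromFin∘toFin v)

toFin∘fromFin : ∀ {n} (k : Fin (2 ^ n)) → toFin (fromFin {n} k) ≡ k
toFin∘fromFin {zero} zero = refl
toFin∘fromFin {suc n} k with splitAt (2 ^ n) k in eq
... | inj₁ k′ = trans (cong (_↑ˡ (2 ^ n + 0)) (toFin∘fromFin {n} k′)) (Finₚ.splitAt⁻¹-↑ˡ eq)
... | inj₂ k′ with splitAt (2 ^ n) {0} k′ in eq′
...   | inj₁ k″ = begin
  (2 ^ n) ↑ʳ (toFin (fromFin {n} k″) ↑ˡ 0)  ≡⟨ cong (λ z → (2 ^ n) ↑ʳ (z ↑ˡ 0)) (toFin∘fromFin {n} k″) ⟩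
  (2 ^ n) ↑ʳ (k″ ↑ˡ 0)                  ≡⟨ cong ((2 ^ n) ↑ʳ_) (Finₚ.splitAt⁻¹-↑ˡ eq′) ⟩
  (2 ^ n) ↑ʳ k′                         ≡⟨ Finₚ.splitAt⁻¹-↑ʳ eq ⟩
  k                                     ∎
  where open ≡-Reasoning

toFin-injective : ∀ {n} → Injective _≡_ _≡_ (toFin {n})
toFin-injective {x = u} {v} eq = trans (sym (fromFin∘toFin u)) (trans (cong fromFin eq) (fromFin∘toFin v))

fromFin-injective : ∀ {n} → Injective _≡_ _≡_ (fromFin {n})
fromFin-injective {n} {k} {l} eq = trans (sym (toFin∘fromFin {n} k)) (trans (cong toFin eq) (toFin∘fromFin {n} l))

cube-injective⇒surjective : ∀ {n} (G : Cube n → Cube n) → Injective _≡_ _≡_ G → ∀ x → ∃ λ v → G v ≡ x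
cube-injective⇒surjective G G-injective x
  with k , hit ← injective⇒surjective (toFin ∘ G ∘ fromFin)
                   (fromFin-injective ∘ G-injective ∘ toFin-injective) (toFin x)
  = fromFin k , toFin-injective hit

-- Q_n − x has an odd number 2^n − 1 of vertices, so no involution of it can switch the parity of every vertex.
punctured-cube-has-no-parity-switching-involution :
  ∀ {n} → Fin n → (x : Cube n) (P : Cube n → Cube n) →
  (∀ u → parity (P u) ≡ not (parity u)) → (∀ u → u ≢ x → P u ≢ x) → (∀ u → u ≢ x → P (P u) ≡ u) → ⊥
punctured-cube-has-no-parity-switching-involution {n} i x P P-parity P-avoids P-involutive
  = let v , Gv≡x = cube-injective⇒surjective G (λ {u} {w} → G′-injective u w (class u) (class w)) x
    in G′-avoids v (class v) Gv≡x
  where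
  -- G maps the parity class of x to the other class by flipping coordinate i, and the other class
  -- back by P; it is injective and misses x.
  G′ : (u : Cube n) → Dec (parity u ≡ parity x) → Cube n
  G′ u (yes _) = flip u i
  G′ u (no _) = P u

  class : (u : Cube n) → Dec (parity u ≡ parity x)
  class u = parity u Boolₚ.≟ parity x

  G : Cube n → Cube n
  G u = G′ u (class u)

  off-class : ∀ {u} → parity u ≢ parity x → u ≢ x
  off-class ne refl = ne refl

  parity-flipped : ∀ u → parity u ≡ parity x → parity (flip u i) ≡ not (parity x)
  parity-flipped u eq = trans (parity-flip u i) (cong not eq)

  parity-matched : ∀ u → parity u ≢ parity x → parity (P u) ≡ parity x
  parity-matched u ne = trans (P-parity u) (trans (cong not (Boolₚ.¬-not ne)) (Boolₚ.not-involutive _))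

  G′-avoids : ∀ u p → G′ u p ≢ x
  G′-avoids u (yes eq) Gu≡x = Boolₚ.not-¬ refl (sym (trans (sym (parity-flipped u eq)) (cong parity Gu≡x)))
  G′-avoids u (no ne) = P-avoids u (off-class ne)

  G′-injective : ∀ u w p q → G′ u p ≡ G′ w q → u ≡ w
  G′-injective u w (yes _) (yes _) eq = flip-injective i eq
  G′-injective u w (no ne) (no ne′) eq = begin
    u         ≡⟨ P-involutive u (off-class ne) ⟨
    P (P u)   ≡⟨ cong P eq ⟩
    P (P w)   ≡⟨ P-involutive w (off-class ne′) ⟩
    w         ∎
    where open ≡-Reasoning
  G′-injective u w (yes eq) (no ne) Gu≡Gw =
    ⊥-elim (Boolₚ.not-¬ refl (sym (trans (sym (parity-flipped u eq)) (trans (cong parity Gu≡Gw) (parity-matched w ne)))))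
  G′-injective u w (no ne) (yes eq) Gu≡Gw = sym (G′-injective w u (yes eq) (no ne) (sym Gu≡Gw))

allCube : ∀ n → List (Cube n)
allCube n = map fromFin (allFin (2 ^ n))

∈-allCube : ∀ {n} (v : Cube n) → v ∈ allCube n
∈-allCube v = subst (_∈ allCube _) (fromFin∘toFin v) (∈-map⁺ fromFin (∈-allFin (toFin v)))

∈⇒any-≡ᵇ : ∀ {k} {us : List ℕ} → k ∈ us → T (any (_≡ᵇ k) us)
∈⇒any-≡ᵇ {k} = Anyₚ.any⁺ (_≡ᵇ k) ∘ Any.map (λ k≡c → ℕₚ.≡⇒≡ᵇ _ k (sym k≡c))

any-≡ᵇ⇒∈ : ∀ {k} (us : List ℕ) → T (any (_≡ᵇ k) us) → k ∈ us
any-≡ᵇ⇒∈ {k} us = Any.map (λ t → sym (ℕₚ.≡ᵇ⇒≡ _ k t)) ∘ Anyₚ.any⁻ (_≡ᵇ k) us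

≤-length : ∀ m (us : List ℕ) → (∀ k → 1 ≤ k → k ≤ m → k ∈ us) → m ≤ length us
≤-length m us occurs = Finₚ.injective⇒≤ position-injective
  where
  position : Fin m → Fin (length us)
  position i = index (occurs (suc (toℕ i)) (s≤s z≤n) (Finₚ.toℕ<n i))

  position-injective : ∀ {i j} → position i ≡ position j → i ≡ j
  position-injective eq =
    Finₚ.toℕ-injective (ℕₚ.suc-injective (SetoidMembershipₚ.index-injective (setoid ℕ) _ _ eq))

firstFreeFrom-≡ : ∀ (us : List ℕ) c fuel k → k ≤ c → c ≤ k + fuel →
                  (∀ k′ → k ≤ k′ → k′ < c → k′ ∈ us) → c ∉ us → firstFreeFrom fuel k us ≡ c
firstFreeFrom-≡ us c zero k k≤c c≤k+0 _ _ = ℕₚ.≤-antisym k≤c (subst (c ≤_) (ℕₚ.+-identityʳ k) c≤k+0)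
firstFreeFrom-≡ us c (suc fuel) k k≤c c≤k+1+fuel below c∉us with ℕₚ.m≤n⇒m<n∨m≡n k≤c
... | inj₁ k<c
  rewrite Equivalence.to Boolₚ.T-≡ (∈⇒any-≡ᵇ (below k ℕₚ.≤-refl k<c)) =
  firstFreeFrom-≡ us c fuel (suc k) k<c (subst (c ≤_) (ℕₚ.+-suc k fuel) c≤k+1+fuel)
    (λ k′ k<k′ → below k′ (ℕₚ.<⇒≤ k<k′)) c∉us
... | inj₂ refl with any (_≡ᵇ c) us in eq
...   | true = ⊥-elim (c∉us (any-≡ᵇ⇒∈ us (Equivalence.from Boolₚ.T-≡ eq)))
...   | false = refl

firstFree-≡ : ∀ (us : List ℕ) c → 1 ≤ c → (∀ k → 1 ≤ k → k < c → k ∈ us) → c ∉ us → firstFree us ≡ c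
firstFree-≡ us (suc c) 1≤c below c∉us = firstFreeFrom-≡ us (suc c) (suc (length us)) 1 1≤c
  (s≤s (ℕₚ.m≤n⇒m≤1+n (≤-length c us (λ k 1≤k k≤c → below k 1≤k (s≤s k≤c))))) below c∉us

module _ {E : Set} where

  Prefixwise : (List E → E → Set) → List E → List E → Set
  Prefixwise P seen [] = ⊤
  Prefixwise P seen (e ∷ es) = P seen e × Prefixwise P (e ∷ seen) es

  Prefixwise-++ : ∀ {P} seen xs ys → Prefixwise P seen xs → Prefixwise P (xs ʳ++ seen) ys →
                  Prefixwise P seen (xs ++ ys)
  Prefixwise-++ seen [] ys _ ys-ok = ys-ok
  Prefixwise-++ seen (x ∷ xs) ys (x-ok , xs-ok) ys-ok = x-ok , Prefixwise-++ (x ∷ seen) xs ys xs-ok ys-ok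

  Prefixwise-fresh : ∀ seen es → Unique es → (∀ {e} → e ∈ es → e ∉ seen) → Prefixwise (λ S e → e ∉ S) seen es
  Prefixwise-fresh seen [] _ _ = tt
  Prefixwise-fresh seen (e ∷ es) (e∉es ∷ es-unique) fresh = fresh (here refl) , Prefixwise-fresh (e ∷ seen) es es-unique fresh′
    where
    fresh′ : ∀ {f} → f ∈ es → f ∉ e ∷ seen
    fresh′ f∈es (here refl) = All.lookup e∉es f∈es refl
    fresh′ f∈es (there f∈seen) = fresh (there f∈es) f∈seen

  ∈-ʳ++⁺ˡ : ∀ {z : E} xs {ys : List E} → z ∈ xs → z ∈ xs ʳ++ ys
  ∈-ʳ++⁺ˡ xs = Anyₚ.reverseAcc⁺ _ xs ∘ inj₂

  ∈-ʳ++⁺ʳ : ∀ {z : E} xs {ys : List E} → z ∈ ys → z ∈ xs ʳ++ ys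
  ∈-ʳ++⁺ʳ xs = Anyₚ.reverseAcc⁺ _ xs ∘ inj₁

  module Buckets (key : E → ℕ) (L : List E) where

    bucket : ℕ → List E
    bucket n = filter (λ e → key e ≟ n) L

    buckets : ℕ → ℕ → List E
    buckets n zero = []
    buckets n (suc m) = bucket n ++ buckets (suc n) m

    Covers : List E → ℕ → Set
    Covers S n = ∀ {f} → f ∈ L → key f < n → f ∈ S

    buckets-prefixwise : ∀ (P : List E → E → Set) seen →
      (∀ {e} → e ∈ L → ∀ S → seen ⊆ S → Covers S (key e) → P S e) →
      ∀ m n S → seen ⊆ S → Covers S n → Prefixwise P S (buckets n m)
    buckets-prefixwise P seen P-holds zero n S _ _ = tt
    buckets-prefixwise P seen P-holds (suc m) n S seen⊆S covers =
      Prefixwise-++ S (bucket n) (buckets (suc n) m)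
        (in-bucket (bucket n) S (λ e∈b → ∈-filter⁻ (λ e → key e ≟ n) {xs = L} e∈b) seen⊆S covers)
        (buckets-prefixwise P seen P-holds m (suc n) (bucket n ʳ++ S)
          (∈-ʳ++⁺ʳ (bucket n) {S} ∘ seen⊆S) covers′)
      where
      in-bucket : ∀ es S → (∀ {e} → e ∈ es → e ∈ L × key e ≡ n) → seen ⊆ S → Covers S n → Prefixwise P S es
      in-bucket [] S _ _ _ = tt
      in-bucket (e ∷ es) S in-n seen⊆S covers =
        let e∈L , key≡n = in-n (here refl) in
        P-holds e∈L S seen⊆S (subst (Covers S) (sym key≡n) covers) ,
        in-bucket es (e ∷ S) (in-n ∘ there) (there ∘ seen⊆S) (λ f∈L f<n → there (covers f∈L f<n))

      covers′ : Covers (bucket n ʳ++ S) (suc n)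
      covers′ {f} f∈L f<1+n with ℕₚ.m≤n⇒m<n∨m≡n (ℕₚ.≤-pred f<1+n)
      ... | inj₁ f<n = ∈-ʳ++⁺ʳ (bucket n) {S} (covers f∈L f<n)
      ... | inj₂ f≡n = ∈-ʳ++⁺ˡ (bucket n) {S} (∈-filter⁺ (λ e → key e ≟ n) f∈L f≡n)

    ∈-buckets⁻ : ∀ m n {e} → e ∈ buckets n m → e ∈ L × n ≤ key e
    ∈-buckets⁻ (suc m) n e∈ with ∈-++⁻ (bucket n) e∈
    ... | inj₁ e∈b = let e∈L , key≡n = ∈-filter⁻ (λ e → key e ≟ n) {xs = L} e∈b in e∈L , ℕₚ.≤-reflexive (sym key≡n)
    ... | inj₂ e∈bs = let e∈L , n<key = ∈-buckets⁻ m (suc n) e∈bs in e∈L , ℕₚ.<⇒≤ n<key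

    ∈-buckets⁺ : ∀ m n {e} → e ∈ L → n ≤ key e → key e < n + m → e ∈ buckets n m
    ∈-buckets⁺ zero n {e} _ n≤key key<n+0 = ⊥-elim (ℕₚ.<⇒≱ (subst (key e <_) (ℕₚ.+-identityʳ n) key<n+0) n≤key)
    ∈-buckets⁺ (suc m) n {e} e∈L n≤key key<n+1+m with ℕₚ.m≤n⇒m<n∨m≡n n≤key
    ... | inj₂ n≡key = ∈-++⁺ˡ (∈-filter⁺ (λ e → key e ≟ n) e∈L (sym n≡key))
    ... | inj₁ n<key = ∈-++⁺ʳ (bucket n) (∈-buckets⁺ m (suc n) e∈L n<key (subst (key e <_) (ℕₚ.+-suc n m) key<n+1+m))

    buckets-unique : Unique L → ∀ m n → Unique (buckets n m)
    buckets-unique L-unique zero n = []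
    buckets-unique L-unique (suc m) n =
      Uniqueₚ.++⁺ (Uniqueₚ.filter⁺ (λ e → key e ≟ n) L-unique) (buckets-unique L-unique m (suc n)) disjoint
      where
      disjoint : ∀ {e} → ¬ (e ∈ bucket n × e ∈ buckets (suc n) m)
      disjoint (e∈b , e∈bs) =
        ℕₚ.<-irrefl (sym (proj₂ (∈-filter⁻ (λ e → key e ≟ n) {xs = L} e∈b))) (proj₂ (∈-buckets⁻ m (suc n) e∈bs))

module _ {Δ : ℕ} (x : Cube Δ) (d : Fin Δ) where

  y : Cube Δ
  y = flip x d

  x≢y : x ≢ y
  x≢y = flip-≢ x d ∘ sym

  Incident : Cube Δ → Edge⁺ x d → Set
  Incident u (cube v i _ _) = v ≡ u ⊎ flip v i ≡ u
  Incident u xx′ = x ≡ u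
  Incident u yy′ = y ≡ u

  dir : Edge⁺ x d → Fin Δ
  dir (cube _ i _ _) = i
  dir xx′ = d
  dir yy′ = d

  isXY-sound : ∀ {v j} → T (isXY x d v j) → j ≡ d × (v ≡ x ⊎ v ≡ y)
  isXY-sound {v} {j} t with j Finₚ.≟ d | v ≟V x | v ≟V flip x d
  ... | yes j≡d | yes v≡x | _       = j≡d , inj₁ v≡x
  ... | yes j≡d | no _    | yes v≡y = j≡d , inj₂ v≡y

  isXY-complete : ∀ {v} → v ≡ x ⊎ v ≡ y → T (isXY x d v d)
  isXY-complete {v} v∈xy with d Finₚ.≟ d | v ≟V x | v ≟V flip x d | v∈xy
  ... | no d≢d | _     | _     | _        = d≢d refl
  ... | yes _  | yes _ | _     | _        = _
  ... | yes _  | no _  | yes _ | _        = _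
  ... | yes _  | no v≢x | no _ | inj₁ v≡x = v≢x v≡x
  ... | yes _  | no _  | no v≢y | inj₂ v≡y = v≢y v≡y

  -- the endpoint with j-th coordinate 0, which `cube` uses to represent the edge at u in direction j
  low : Cube Δ → Fin Δ → Cube Δ
  low u j = u [ j ]≔ false

  low-incident : ∀ u j → low u j ≡ u ⊎ flip (low u j) j ≡ u
  low-incident u j with lookup u j in eq
  ... | false = inj₁ (Vecₚ.updateAt-id-local j u (sym eq))
  ... | true = inj₂ (trans (Vecₚ.updateAt-updateAt j u) (Vecₚ.updateAt-id-local j u (sym eq)))

  flip-≡⇒≡-flip : ∀ {u v : Cube Δ} {i} → flip v i ≡ u → v ≡ flip u i
  flip-≡⇒≡-flip {v = v} {i} refl = sym (flip-involutive v i)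

  incident-xy : ∀ {u v} → v ≡ x ⊎ v ≡ y → v ≡ u ⊎ flip v d ≡ u → x ≡ u ⊎ y ≡ u
  incident-xy (inj₁ refl) (inj₁ refl) = inj₁ refl
  incident-xy (inj₁ refl) (inj₂ refl) = inj₂ refl
  incident-xy (inj₂ refl) (inj₁ refl) = inj₂ refl
  incident-xy (inj₂ refl) (inj₂ refl) = inj₁ (sym (flip-involutive x d))

  edge-at : ∀ u j → ∃ λ e → Incident u e × dir e ≡ j
  edge-at u j with isXY x d (low u j) j in eq
  ... | false = cube (low u j) j low-j (Equivalence.from Boolₚ.T-not-≡ eq) , low-incident u j , refl
    where
    low-j : T (not (lookup (low u j) j))
    low-j rewrite Vecₚ.lookup∘update j u false = _
  ... | true with isXY-sound {low u j} {j} (Equivalence.from Boolₚ.T-≡ eq)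
  ...   | refl , low∈xy with incident-xy low∈xy (low-incident u d)
  ...     | inj₁ x≡u = xx′ , x≡u , refl
  ...     | inj₂ y≡u = yy′ , y≡u , refl

  edgeAt : Cube Δ → Fin Δ → Edge⁺ x d
  edgeAt u j = proj₁ (edge-at u j)

  edgeAt-incident : ∀ u j → Incident u (edgeAt u j)
  edgeAt-incident u j = proj₁ (proj₂ (edge-at u j))

  dir-edgeAt : ∀ u j → dir (edgeAt u j) ≡ j
  dir-edgeAt u j = proj₂ (proj₂ (edge-at u j))

  cube-≡ : ∀ {v w : Cube Δ} {i : Fin Δ} {p q p′ q′} → v ≡ w → cube {x = x} {d} v i p q ≡ cube w i p′ q′
  cube-≡ refl = cong₂ (cube _ _) (Boolₚ.T-irrelevant _ _) (Boolₚ.T-irrelevant _ _)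

  not-both-low : ∀ {w : Cube Δ} {i : Fin Δ} → T (not (lookup w i)) → T (not (lookup (flip w i) i)) → ⊥
  not-both-low {w} {i} p = subst (λ b → T (not b)) (trans (lookup-flip w i) (cong not (Equivalence.to Boolₚ.T-not-≡ p)))

  low-unique : ∀ {u v w : Cube Δ} {i : Fin Δ} → T (not (lookup v i)) → T (not (lookup w i)) →
               v ≡ u ⊎ flip v i ≡ u → w ≡ u ⊎ flip w i ≡ u → v ≡ w
  low-unique _ _ (inj₁ refl) (inj₁ refl) = refl
  low-unique {w = w} {i} p q (inj₁ refl) (inj₂ refl) = ⊥-elim (not-both-low {w} {i} q p)
  low-unique {v = v} {i = i} p q (inj₂ refl) (inj₁ refl) = ⊥-elim (not-both-low {v} {i} p q)
  low-unique {i = i} _ _ (inj₂ eq) (inj₂ eq′) = flip-injective i (trans eq (sym eq′))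

  ¬isXY⇒ends∉xy : ∀ {u v} → T (not (isXY x d v d)) → v ≡ u ⊎ flip v d ≡ u → x ≡ u ⊎ y ≡ u → ⊥
  ¬isXY⇒ends∉xy {u} {v} q incident u∈xy =
    subst (λ b → T (not b)) (Equivalence.to Boolₚ.T-≡ (isXY-complete (v∈xy incident u∈xy))) q
    where
    v∈xy : v ≡ u ⊎ flip v d ≡ u → x ≡ u ⊎ y ≡ u → v ≡ x ⊎ v ≡ y
    v∈xy (inj₁ refl) (inj₁ refl) = inj₁ refl
    v∈xy (inj₁ refl) (inj₂ refl) = inj₂ refl
    v∈xy (inj₂ eq) (inj₁ refl) = inj₂ (flip-≡⇒≡-flip eq)
    v∈xy (inj₂ eq) (inj₂ refl) = inj₁ (trans (flip-≡⇒≡-flip eq) (flip-involutive x d))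

  incident-dir-injective : ∀ {u} e f → Incident u e → Incident u f → dir e ≡ dir f → e ≡ f
  incident-dir-injective (cube v i p q) (cube w .i p′ q′) ie if refl = cube-≡ (low-unique p p′ ie if)
  incident-dir-injective (cube v i p q) xx′ ie refl refl = ⊥-elim (¬isXY⇒ends∉xy q ie (inj₁ refl))
  incident-dir-injective (cube v i p q) yy′ ie refl refl = ⊥-elim (¬isXY⇒ends∉xy q ie (inj₂ refl))
  incident-dir-injective xx′ (cube w i p q) refl if refl = ⊥-elim (¬isXY⇒ends∉xy q if (inj₁ refl))
  incident-dir-injective yy′ (cube w i p q) refl if refl = ⊥-elim (¬isXY⇒ends∉xy q if (inj₂ refl))
  incident-dir-injective xx′ xx′ _ _ _ = refl
  incident-dir-injective yy′ yy′ _ _ _ = refl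
  incident-dir-injective xx′ yy′ refl y≡x _ = ⊥-elim (x≢y (sym y≡x))
  incident-dir-injective yy′ xx′ refl x≡y _ = ⊥-elim (x≢y x≡y)

  incident-flip : ∀ {u} e → Incident u e → e ≢ xx′ → e ≢ yy′ → Incident (flip u (dir e)) e
  incident-flip (cube v i _ _) (inj₁ refl) _ _ = inj₂ refl
  incident-flip (cube v i _ _) (inj₂ refl) _ _ = inj₁ (sym (flip-involutive v i))
  incident-flip xx′ _ e≢xx′ _ = ⊥-elim (e≢xx′ refl)
  incident-flip yy′ _ _ e≢yy′ = ⊥-elim (e≢yy′ refl)

  _∈ₑ_ : V⁺ Δ → Edge⁺ x d → Set
  w ∈ₑ e = proj₁ (ends e) ≡ w ⊎ proj₂ (ends e) ≡ w

  eqV⁺-complete : ∀ {a b : V⁺ Δ} → a ≡ b → T (eqV⁺ a b)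
  eqV⁺-complete {old u} refl = fromWitness refl
  eqV⁺-complete {x′} refl = _
  eqV⁺-complete {y′} refl = _

  eqV⁺-sound : ∀ a b → T (eqV⁺ {Δ} a b) → a ≡ b
  eqV⁺-sound (old u) (old v) t = cong old (toWitness t)
  eqV⁺-sound x′ x′ _ = refl
  eqV⁺-sound y′ y′ _ = refl
  eqV⁺-sound (old _) x′ ()
  eqV⁺-sound (old _) y′ ()
  eqV⁺-sound x′ (old _) ()
  eqV⁺-sound x′ y′ ()
  eqV⁺-sound y′ (old _) ()
  eqV⁺-sound y′ x′ ()

  share-intro : ∀ {w} e f → w ∈ₑ e → w ∈ₑ f → Share e f
  share-intro e f = intro (ends e) (ends f)
    where
    intro : ∀ {w} (p q : V⁺ Δ × V⁺ Δ) →
            proj₁ p ≡ w ⊎ proj₂ p ≡ w → proj₁ q ≡ w ⊎ proj₂ q ≡ w →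
            T (eqV⁺ (proj₁ p) (proj₁ q) ∨ eqV⁺ (proj₁ p) (proj₂ q) ∨ eqV⁺ (proj₂ p) (proj₁ q) ∨ eqV⁺ (proj₂ p) (proj₂ q))
    intro (a , b) (c , c′) (inj₁ r) (inj₁ s) = orˡ (eqV⁺ a c) (eqV⁺-complete (trans r (sym s)))
    intro (a , b) (c , c′) (inj₁ r) (inj₂ s) = orʳ (eqV⁺ a c) (orˡ (eqV⁺ a c′) (eqV⁺-complete (trans r (sym s))))
    intro (a , b) (c , c′) (inj₂ r) (inj₁ s) =
      orʳ (eqV⁺ a c) (orʳ (eqV⁺ a c′) (orˡ (eqV⁺ b c) (eqV⁺-complete (trans r (sym s)))))
    intro (a , b) (c , c′) (inj₂ r) (inj₂ s) =
      orʳ (eqV⁺ a c) (orʳ (eqV⁺ a c′) (orʳ (eqV⁺ b c) (eqV⁺-complete (trans r (sym s)))))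

  share-elim : ∀ e f → Share e f → ∃ λ w → w ∈ₑ e × w ∈ₑ f
  share-elim e f = elim (ends e) (ends f)
    where
    elim : ∀ (p q : V⁺ Δ × V⁺ Δ) →
           T (eqV⁺ (proj₁ p) (proj₁ q) ∨ eqV⁺ (proj₁ p) (proj₂ q) ∨ eqV⁺ (proj₂ p) (proj₁ q) ∨ eqV⁺ (proj₂ p) (proj₂ q)) →
           ∃ λ w → (proj₁ p ≡ w ⊎ proj₂ p ≡ w) × (proj₁ q ≡ w ⊎ proj₂ q ≡ w)
    elim (a , b) (c , c′) t with or-elim (eqV⁺ a c) t
    ... | inj₁ t₁ = a , inj₁ refl , inj₁ (sym (eqV⁺-sound a c t₁))
    ... | inj₂ t₂ with or-elim (eqV⁺ a c′) t₂
    ...   | inj₁ t₃ = a , inj₁ refl , inj₂ (sym (eqV⁺-sound a c′ t₃))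
    ...   | inj₂ t₄ with or-elim (eqV⁺ b c) t₄
    ...     | inj₁ t₅ = b , inj₂ refl , inj₁ (sym (eqV⁺-sound b c t₅))
    ...     | inj₂ t₆ = b , inj₂ refl , inj₂ (sym (eqV⁺-sound b c′ t₆))

  incident⇒∈ₑ : ∀ {u} e → Incident u e → old u ∈ₑ e
  incident⇒∈ₑ (cube _ _ _ _) = Sum.map (cong old) (cong old)
  incident⇒∈ₑ xx′ = inj₁ ∘ cong old
  incident⇒∈ₑ yy′ = inj₁ ∘ cong old

  old-injective : ∀ {u v : Cube Δ} → old u ≡ old v → u ≡ v
  old-injective refl = refl

  ∈ₑ⇒incident : ∀ {u} e → old u ∈ₑ e → Incident u e
  ∈ₑ⇒incident (cube _ _ _ _) = Sum.map old-injective old-injective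
  ∈ₑ⇒incident xx′ (inj₁ eq) = old-injective eq
  ∈ₑ⇒incident yy′ (inj₁ eq) = old-injective eq

  share-at : ∀ {u} e f → Incident u e → Incident u f → Share e f
  share-at e f ie if = share-intro e f (incident⇒∈ₑ e ie) (incident⇒∈ₑ f if)

  x′∈ₑ⇒≡xx′ : ∀ e → x′ ∈ₑ e → e ≡ xx′
  x′∈ₑ⇒≡xx′ xx′ _ = refl
  x′∈ₑ⇒≡xx′ (cube _ _ _ _) (inj₁ ())
  x′∈ₑ⇒≡xx′ (cube _ _ _ _) (inj₂ ())
  x′∈ₑ⇒≡xx′ yy′ (inj₁ ())
  x′∈ₑ⇒≡xx′ yy′ (inj₂ ())

  y′∈ₑ⇒≡yy′ : ∀ e → y′ ∈ₑ e → e ≡ yy′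
  y′∈ₑ⇒≡yy′ yy′ _ = refl
  y′∈ₑ⇒≡yy′ (cube _ _ _ _) (inj₁ ())
  y′∈ₑ⇒≡yy′ (cube _ _ _ _) (inj₂ ())
  y′∈ₑ⇒≡yy′ xx′ (inj₁ ())
  y′∈ₑ⇒≡yy′ xx′ (inj₂ ())

  share-dir-injective : ∀ e f → Share e f → dir e ≡ dir f → e ≡ f
  share-dir-injective e f s with share-elim e f s
  ... | old u , ue , uf = incident-dir-injective e f (∈ₑ⇒incident e ue) (∈ₑ⇒incident f uf)
  ... | x′ , x′e , x′f = λ _ → trans (x′∈ₑ⇒≡xx′ e x′e) (sym (x′∈ₑ⇒≡xx′ f x′f))
  ... | y′ , y′e , y′f = λ _ → trans (y′∈ₑ⇒≡yy′ e y′e) (sym (y′∈ₑ⇒≡yy′ f y′f))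

  _≟E_ : DecidableEquality (Edge⁺ x d)
  cube v i p q ≟E cube w j p′ q′ with v ≟V w | i Finₚ.≟ j
  ... | yes refl | yes refl = yes (cube-≡ refl)
  ... | no v≢w   | _        = no λ { refl → v≢w refl }
  ... | yes _    | no i≢j   = no λ { refl → i≢j refl }
  cube _ _ _ _ ≟E xx′ = no λ ()
  cube _ _ _ _ ≟E yy′ = no λ ()
  xx′ ≟E cube _ _ _ _ = no λ ()
  xx′ ≟E xx′ = yes refl
  xx′ ≟E yy′ = no λ ()
  yy′ ≟E cube _ _ _ _ = no λ ()
  yy′ ≟E xx′ = no λ ()
  yy′ ≟E yy′ = yes refl

  module _ (α : Edge⁺ x d → Fin Δ) (α-proper : Proper α) where

    proper-injective : ∀ e f → Share e f → α e ≡ α f → e ≡ f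
    proper-injective e f s eq with e ≟E f
    ... | yes e≡f = e≡f
    ... | no e≢f = ⊥-elim (α-proper e f e≢f s eq)

    colour-at : ∀ u c → ∃ λ e → Incident u e × α e ≡ c
    colour-at u c =
      let j , αj≡c = injective⇒surjective (α ∘ edgeAt u) α-edgeAt-injective c
      in edgeAt u j , edgeAt-incident u j , αj≡c
      where
      α-edgeAt-injective : Injective _≡_ _≡_ (α ∘ edgeAt u)
      α-edgeAt-injective {j} {k} eq = begin
        j                    ≡⟨ dir-edgeAt u j ⟨
        dir (edgeAt u j)     ≡⟨ cong dir (proper-injective _ _ (share-at _ _ (edgeAt-incident u j) (edgeAt-incident u k)) eq) ⟩
        dir (edgeAt u k)     ≡⟨ dir-edgeAt u k ⟩
        k                    ∎
        where open ≡-Reasoning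

    pendant-colours-agree : α xx′ ≡ α yy′
    pendant-colours-agree with α xx′ Finₚ.≟ α yy′
    ... | yes eq = eq
    ... | no xx′≢yy′ =
      ⊥-elim (punctured-cube-has-no-parity-switching-involution d x P (λ u → parity-flip u _) P-avoids P-involutive)
      where
      c-edge : Cube Δ → Edge⁺ x d
      c-edge u = proj₁ (colour-at u (α xx′))

      c-edge-incident : ∀ u → Incident u (c-edge u)
      c-edge-incident u = proj₁ (proj₂ (colour-at u (α xx′)))

      c-edge-colour : ∀ u → α (c-edge u) ≡ α xx′
      c-edge-colour u = proj₂ (proj₂ (colour-at u (α xx′)))

      P : Cube Δ → Cube Δ
      P u = flip u (dir (c-edge u))

      c-edge-incident-P : ∀ u → u ≢ x → Incident (P u) (c-edge u)
      c-edge-incident-P u u≢x = incident-flip (c-edge u) (c-edge-incident u)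
        (λ e≡xx′ → u≢x (sym (subst (Incident u) e≡xx′ (c-edge-incident u))))
        (λ e≡yy′ → xx′≢yy′ (trans (sym (c-edge-colour u)) (cong α e≡yy′)))

      P-avoids : ∀ u → u ≢ x → P u ≢ x
      P-avoids u u≢x Pu≡x = u≢x (sym (subst (Incident u) c-edge≡xx′ (c-edge-incident u)))
        where
        c-edge≡xx′ : c-edge u ≡ xx′
        c-edge≡xx′ = proper-injective _ _
          (share-at _ xx′ (subst (λ w → Incident w (c-edge u)) Pu≡x (c-edge-incident-P u u≢x)) refl)
          (c-edge-colour u)

      P-involutive : ∀ u → u ≢ x → P (P u) ≡ u
      P-involutive u u≢x = begin
        flip (P u) (dir (c-edge (P u)))   ≡⟨ cong (flip (P u) ∘ dir) same-edge ⟩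
        flip (P u) (dir (c-edge u))       ≡⟨ flip-involutive u _ ⟩
        u                                 ∎
        where
        open ≡-Reasoning
        same-edge : c-edge (P u) ≡ c-edge u
        same-edge = proper-injective _ _ (share-at _ _ (c-edge-incident (P u)) (c-edge-incident-P u u≢x))
          (trans (c-edge-colour (P u)) (sym (c-edge-colour u)))

  module _ (col : Edge⁺ x d → ℕ) where

    coloured : List (Edge⁺ x d) → List (Edge⁺ x d × ℕ)
    coloured = map (λ f → f , col f)

    SeesSmallerColours : List (Edge⁺ x d) → Edge⁺ x d → Set
    SeesSmallerColours S e = ∀ k → 1 ≤ k → k < col e → ∃ λ f → f ∈ S × Share f e × col f ≡ k

    usedAt : List (Edge⁺ x d) → Edge⁺ x d → List ℕ
    usedAt S e = map proj₂ (filterᵇ (λ p → shareB (proj₁ p) e) (coloured S))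

    ∈-usedAt⁺ : ∀ {S e f} → f ∈ S → Share f e → col f ∈ usedAt S e
    ∈-usedAt⁺ {e = e} f∈S f~e = ∈-map⁺ proj₂ (∈-filter⁺ (T? ∘ λ p → shareB (proj₁ p) e) (∈-map⁺ (λ f → f , col f) f∈S) f~e)

    ∈-usedAt⁻ : ∀ {S e k} → k ∈ usedAt S e → ∃ λ f → f ∈ S × Share f e × col f ≡ k
    ∈-usedAt⁻ {S} {e} k∈used with ∈-map⁻ proj₂ k∈used
    ... | p , p∈filtered , refl with ∈-filter⁻ (T? ∘ λ p → shareB (proj₁ p) e) {xs = coloured S} p∈filtered
    ...   | p∈coloured , p~e with ∈-map⁻ (λ f → f , col f) p∈coloured
    ...     | f , f∈S , refl = f , f∈S , p~e , refl

    module _ (col-positive : ∀ e → 1 ≤ col e) (col-proper : Proper col) where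

      greedy-step : ∀ S e → SeesSmallerColours S e → e ∉ S → firstFree (usedAt S e) ≡ col e
      greedy-step S e sees e∉S = firstFree-≡ (usedAt S e) (col e) (col-positive e)
        (λ k 1≤k k<c → let f , f∈S , f~e , fk = sees k 1≤k k<c in subst (_∈ usedAt S e) fk (∈-usedAt⁺ {S} {e} f∈S f~e))
        (λ c∈used → let f , f∈S , f~e , fc = ∈-usedAt⁻ {S} {e} c∈used in
          col-proper f e (λ f≡e → e∉S (subst (_∈ S) f≡e f∈S)) f~e fc)

      greedy-reproduces : ∀ S es → Prefixwise SeesSmallerColours S es → Prefixwise (λ S e → e ∉ S) S es →
                          greedy (coloured S) es ≡ coloured (es ʳ++ S)
      greedy-reproduces S [] _ _ = refl
      greedy-reproduces S (e ∷ es) (sees , sees-rest) (e∉S , fresh-rest)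
        rewrite greedy-step S e sees e∉S = greedy-reproduces (e ∷ S) es sees-rest fresh-rest

  Prefixwise⇒Conn : ∀ seen es → Prefixwise (λ S e → Any (λ f → Share f e) S) seen es → Conn {x = x} {d} seen es
  Prefixwise⇒Conn seen [] _ = tt
  Prefixwise⇒Conn seen (e ∷ es) (adj , rest) = adj , Prefixwise⇒Conn (e ∷ seen) es rest

  module _ (i : ℕ) (t : Fin Δ) (t+1≡i : suc (toℕ t) ≡ i) (j₀ : Fin Δ) (j₀≢d : j₀ ≢ d) where

    colourOf : Fin Δ → ℕ
    colourOf j = suc (toℕ (transpose d t j))

    colourOf-injective : ∀ {j k} → colourOf j ≡ colourOf k → j ≡ k
    colourOf-injective {j} {k} eq = begin
      j                             ≡⟨ transpose-inverse t d ⟨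
      transpose t d (transpose d t j) ≡⟨ cong (transpose t d) (Finₚ.toℕ-injective (ℕₚ.suc-injective eq)) ⟩
      transpose t d (transpose d t k) ≡⟨ transpose-inverse t d ⟩
      k                             ∎
      where open ≡-Reasoning

    colourOf≤Δ : ∀ j → colourOf j ≤ Δ
    colourOf≤Δ j = Finₚ.toℕ<n (transpose d t j)

    colourOf-surjective : ∀ k → 1 ≤ k → k ≤ Δ → ∃ λ j → colourOf j ≡ k
    colourOf-surjective (suc k) _ k<Δ =
      transpose t d (fromℕ< k<Δ) , cong suc (trans (cong toℕ (transpose-inverse d t)) (Finₚ.toℕ-fromℕ< k<Δ))

    colourOf-d : colourOf d ≡ i
    colourOf-d with d Finₚ.≟ d
    ... | yes _ = t+1≡i
    ... | no d≢d = ⊥-elim (d≢d refl)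

    col : Edge⁺ x d → ℕ
    col = colourOf ∘ dir

    col-proper : Proper col
    col-proper e f e≢f e~f eq = e≢f (share-dir-injective e f e~f (colourOf-injective eq))

    -- y has lost its edge in direction d, so on y's side of direction d the descent goes towards
    -- the neighbour b′ of y, whose d-edge leads back to x's side
    b′ : Cube Δ
    b′ = flip y j₀

    b′-d : lookup b′ d ≡ not (lookup x d)
    b′-d = trans (lookup-flip-≢ y (j₀≢d ∘ sym)) (lookup-flip x d)

    b′≢x : b′ ≢ x
    b′≢x = lookup-not⇒≢ d b′-d

    b′≢y : b′ ≢ y
    b′≢y = flip-≢ y j₀

    rank : Cube Δ → ℕ
    rank u with lookup u d Boolₚ.≟ lookup x d
    ... | yes _ = dist u x
    ... | no _ = suc Δ + dist u b′

    rank-near : ∀ u → lookup u d ≡ lookup x d → rank u ≡ dist u x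
    rank-near u near with lookup u d Boolₚ.≟ lookup x d
    ... | yes _ = refl
    ... | no far = ⊥-elim (far near)

    rank-far : ∀ u → lookup u d ≢ lookup x d → rank u ≡ suc Δ + dist u b′
    rank-far u far with lookup u d Boolₚ.≟ lookup x d
    ... | yes near = ⊥-elim (far near)
    ... | no _ = refl

    rank≤ : ∀ u → rank u ≤ suc Δ + Δ
    rank≤ u with lookup u d Boolₚ.≟ lookup x d
    ... | yes _ = ℕₚ.≤-trans (dist≤dim u x) (ℕₚ.m≤n+m Δ (suc Δ))
    ... | no _ = ℕₚ.+-monoʳ-≤ (suc Δ) (dist≤dim u b′)

    edgeAt-flip : ∀ u j → ¬ (j ≡ d × (x ≡ u ⊎ y ≡ u)) → edgeAt u j ≢ xx′ × Incident (flip u j) (edgeAt u j)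
    edgeAt-flip u j not-pendant = ≢xx′ , subst (λ i → Incident (flip u i) (edgeAt u j)) (dir-edgeAt u j)
      (incident-flip (edgeAt u j) (edgeAt-incident u j) ≢xx′ ≢yy′)
      where
      dir≡d : ∀ {e} → edgeAt u j ≡ e → dir e ≡ d → j ≡ d
      dir≡d eq dir-e = trans (sym (dir-edgeAt u j)) (trans (cong dir eq) dir-e)

      ≢xx′ : edgeAt u j ≢ xx′
      ≢xx′ eq = not-pendant (dir≡d eq refl , inj₁ (subst (Incident u) eq (edgeAt-incident u j)))

      ≢yy′ : edgeAt u j ≢ yy′
      ≢yy′ eq = not-pendant (dir≡d eq refl , inj₂ (subst (Incident u) eq (edgeAt-incident u j)))

    Descends : Cube Δ → Set
    Descends u = ∃ λ e → Incident u e × e ≢ xx′ × ∃ λ w → Incident w e × rank w < rank u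

    descends-along : ∀ u j → ¬ (j ≡ d × (x ≡ u ⊎ y ≡ u)) → rank (flip u j) < rank u → Descends u
    descends-along u j not-pendant lt =
      edgeAt u j , edgeAt-incident u j , proj₁ (edgeAt-flip u j not-pendant) ,
      flip u j , proj₂ (edgeAt-flip u j not-pendant) , lt

    descends-near : ∀ u → u ≢ x → lookup u d ≡ lookup x d → Descends u
    descends-near u u≢x near = descends-along u j (j≢d ∘ proj₁)
      (subst₂ _<_ (sym (rank-near (flip u j) near′)) (sym (rank-near u near)) (ℕₚ.≤-reflexive (dist-flip u x j uj≢xj)))
      where
      j = proj₁ (≢⇒lookup-≢ u x u≢x)
      uj≢xj = proj₂ (≢⇒lookup-≢ u x u≢x)
      j≢d : j ≢ d
      j≢d j≡d = uj≢xj (subst (λ i → lookup u i ≡ lookup x i) (sym j≡d) near)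
      near′ : lookup (flip u j) d ≡ lookup x d
      near′ = trans (lookup-flip-≢ u (j≢d ∘ sym)) near

    descends-far : ∀ u → u ≢ b′ → lookup u d ≢ lookup x d → Descends u
    descends-far u u≢b′ far = descends-along u j (j≢d ∘ proj₁)
      (subst₂ _<_ (sym (rank-far (flip u j) far′)) (sym (rank-far u far))
        (ℕₚ.+-monoʳ-< (suc Δ) (ℕₚ.≤-reflexive (dist-flip u b′ j uj≢b′j))))
      where
      j = proj₁ (≢⇒lookup-≢ u b′ u≢b′)
      uj≢b′j = proj₂ (≢⇒lookup-≢ u b′ u≢b′)
      j≢d : j ≢ d
      j≢d j≡d = uj≢b′j (subst (λ i → lookup u i ≡ lookup b′ i) (sym j≡d) (trans (Boolₚ.¬-not far) (sym b′-d)))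
      far′ : lookup (flip u j) d ≢ lookup x d
      far′ = far ∘ trans (sym (lookup-flip-≢ u (j≢d ∘ sym)))

    b′-descends : Descends b′
    b′-descends = descends-along b′ d b′-not-pendant (begin-strict
      rank (flip b′ d)   ≡⟨ rank-near (flip b′ d) near′ ⟩
      dist (flip b′ d) x ≤⟨ dist≤dim (flip b′ d) x ⟩
      Δ                  <⟨ ℕₚ.n<1+n Δ ⟩
      suc Δ              ≤⟨ ℕₚ.m≤m+n (suc Δ) _ ⟩
      suc Δ + dist b′ b′ ≡⟨ rank-far b′ (λ eq → Boolₚ.not-¬ refl (trans (sym eq) b′-d)) ⟨
      rank b′            ∎)
      where
      open ℕₚ.≤-Reasoning
      b′-not-pendant : ¬ (d ≡ d × (x ≡ b′ ⊎ y ≡ b′))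
      b′-not-pendant (_ , inj₁ x≡b′) = b′≢x (sym x≡b′)
      b′-not-pendant (_ , inj₂ y≡b′) = b′≢y (sym y≡b′)
      near′ : lookup (flip b′ d) d ≡ lookup x d
      near′ = trans (lookup-flip b′ d) (trans (cong not b′-d) (Boolₚ.not-involutive _))

    descends : ∀ u → u ≢ x → Descends u
    descends u u≢x = by-cases (lookup u d Boolₚ.≟ lookup x d) (u ≟V b′)
      where
      by-cases : Dec (lookup u d ≡ lookup x d) → Dec (u ≡ b′) → Descends u
      by-cases (yes near) _ = descends-near u u≢x near
      by-cases (no far) (no u≢b′) = descends-far u u≢b′ far
      by-cases (no _) (yes u≡b′) = subst Descends (sym u≡b′) b′-descends

    lowRank : Edge⁺ x d → ℕ
    lowRank (cube v i _ _) = rank v ⊓ rank (flip v i)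
    lowRank xx′ = 0
    lowRank yy′ = rank y

    lowRank≤ : ∀ {w} e → Incident w e → lowRank e ≤ rank w
    lowRank≤ (cube v i _ _) (inj₁ refl) = ℕₚ.m⊓n≤m (rank v) (rank (flip v i))
    lowRank≤ (cube v i _ _) (inj₂ refl) = ℕₚ.m⊓n≤n (rank v) (rank (flip v i))
    lowRank≤ xx′ _ = z≤n
    lowRank≤ yy′ refl = ℕₚ.≤-refl

    lowest-end : ∀ e → e ≢ xx′ → ∃ λ u → Incident u e × lowRank e ≡ rank u
    lowest-end (cube v i _ _) _ with ℕₚ.≤-total (rank v) (rank (flip v i))
    ... | inj₁ v≤ = v , inj₁ refl , ℕₚ.m≤n⇒m⊓n≡m v≤
    ... | inj₂ ≥v = flip v i , inj₂ refl , ℕₚ.m≥n⇒m⊓n≡n ≥v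
    lowest-end xx′ xx′≢xx′ = ⊥-elim (xx′≢xx′ refl)
    lowest-end yy′ _ = y , refl , refl

    key : Edge⁺ x d → ℕ
    key e = lowRank e * suc Δ + col e

    keyBound : ℕ
    keyBound = suc ((suc Δ + Δ) * suc Δ + Δ)

    lowRank≤bound : ∀ e → lowRank e ≤ suc Δ + Δ
    lowRank≤bound (cube v i _ _) = ℕₚ.≤-trans (ℕₚ.m⊓n≤m (rank v) _) (rank≤ v)
    lowRank≤bound xx′ = z≤n
    lowRank≤bound yy′ = rank≤ y

    key<keyBound : ∀ e → key e < keyBound
    key<keyBound e = s≤s (ℕₚ.+-mono-≤ (ℕₚ.*-monoˡ-≤ (suc Δ) (lowRank≤bound e)) (colourOf≤Δ (dir e)))

    key-<-by-rank : ∀ {a b k l} → a < b → k ≤ Δ → a * suc Δ + k < b * suc Δ + l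
    key-<-by-rank {a} {b} {k} {l} a<b k≤Δ = begin-strict
      a * suc Δ + k       <⟨ ℕₚ.+-monoʳ-< (a * suc Δ) (s≤s k≤Δ) ⟩
      a * suc Δ + suc Δ   ≡⟨ ℕₚ.+-comm (a * suc Δ) (suc Δ) ⟩
      suc a * suc Δ       ≤⟨ ℕₚ.*-monoˡ-≤ (suc Δ) a<b ⟩
      b * suc Δ           ≤⟨ ℕₚ.m≤m+n (b * suc Δ) l ⟩
      b * suc Δ + l       ∎
      where open ℕₚ.≤-Reasoning

    key-<-by-colour : ∀ {a b k l} → a ≤ b → k < l → a * suc Δ + k < b * suc Δ + l
    key-<-by-colour a≤b k<l = ℕₚ.+-mono-≤-< (ℕₚ.*-monoˡ-≤ (suc Δ) a≤b) k<l

    allEdges : List (Edge⁺ x d)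
    allEdges = concatMap (λ u → map (edgeAt u) (allFin Δ)) (allCube Δ)

    some-end : ∀ e → ∃ λ u → Incident u e
    some-end (cube v _ _ _) = v , inj₁ refl
    some-end xx′ = x , refl
    some-end yy′ = y , refl

    ∈-allEdges : ∀ e → e ∈ allEdges
    ∈-allEdges e = subst (_∈ allEdges) e≡edgeAt
      (∈-concatMap⁺ (λ v → map (edgeAt v) (allFin Δ)) (Any.map (λ { refl → ∈-map⁺ (edgeAt u) (∈-allFin (dir e)) }) (∈-allCube u)))
      where
      u = proj₁ (some-end e)
      e≡edgeAt : edgeAt u (dir e) ≡ e
      e≡edgeAt = incident-dir-injective _ e (edgeAt-incident u (dir e)) (proj₂ (some-end e)) (dir-edgeAt u (dir e))

    others : List (Edge⁺ x d)
    others = deduplicate _≟E_ (filter (λ e → ¬? (e ≟E xx′)) allEdges)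

    ∈-others : ∀ {e} → e ≢ xx′ → e ∈ others
    ∈-others {e} e≢xx′ = ∈-deduplicate⁺ _≟E_ (∈-filter⁺ (λ e → ¬? (e ≟E xx′)) (∈-allEdges e) e≢xx′)

    xx′∉others : xx′ ∉ others
    xx′∉others xx′∈ =
      proj₂ (∈-filter⁻ (λ e → ¬? (e ≟E xx′)) {xs = allEdges} (∈-deduplicate⁻ _≟E_ _ xx′∈)) refl

    others-unique : Unique others
    others-unique = DecUniqueₚ.deduplicate-! _≟E_ _

    open Buckets key others

    ≢xx′ : ∀ {e} → e ∈ others → e ≢ xx′
    ≢xx′ e∈ refl = xx′∉others e∈

    sees-smaller-colours : ∀ {e} → e ∈ others → ∀ S → xx′ ∷ [] ⊆ S → Covers S (key e) → SeesSmallerColours col S e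
    sees-smaller-colours {e} e∈ S xx′∈S covers k 1≤k k<col
      with u , u-e , low≡rank ← lowest-end e (≢xx′ e∈)
      with j , colour-j ← colourOf-surjective k 1≤k (ℕₚ.≤-trans (ℕₚ.<⇒≤ k<col) (colourOf≤Δ (dir e)))
      = f , f∈S , share-at f e (edgeAt-incident u j) u-e , col-f
      where
      f = edgeAt u j

      col-f : col f ≡ k
      col-f = trans (cong colourOf (dir-edgeAt u j)) colour-j

      key-f<key-e : key f < key e
      key-f<key-e = subst (λ r → key f < r * suc Δ + col e) (sym low≡rank)
        (key-<-by-colour (lowRank≤ f (edgeAt-incident u j)) (subst (_< col e) (sym col-f) k<col))

      f∈S : f ∈ S
      f∈S with f ≟E xx′
      ... | yes f≡xx′ = subst (_∈ S) (sym f≡xx′) (xx′∈S (here refl))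
      ... | no f≢xx′ = covers (∈-others f≢xx′) key-f<key-e

    adjacent-earlier : ∀ {e} → e ∈ others → ∀ S → xx′ ∷ [] ⊆ S → Covers S (key e) → Any (λ f → Share f e) S
    adjacent-earlier {e} e∈ S xx′∈S covers with lowest-end e (≢xx′ e∈)
    ... | u , u-e , low≡rank with u ≟V x
    ...   | yes refl = Any.map (λ { refl → share-at xx′ e refl u-e }) (xx′∈S (here refl))
    ...   | no u≢x with descends u u≢x
    ...     | g , u-g , g≢xx′ , w , w-g , w<u =
      Any.map (λ { refl → share-at g e u-g u-e }) (covers (∈-others g≢xx′) key-g<key-e)
      where
      key-g<key-e : key g < key e
      key-g<key-e = subst (λ r → key g < r * suc Δ + col e) (sym low≡rank)
        (key-<-by-rank (ℕₚ.≤-<-trans (lowRank≤ g w-g) w<u) (colourOf≤Δ (dir g)))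

    order : List (Edge⁺ x d)
    order = buckets 0 keyBound

    colours-≤Δ : ∀ es → All (λ p → proj₂ p ≤ Δ) (coloured col es)
    colours-≤Δ = Allₚ.map⁺ ∘ All.universal (colourOf≤Δ ∘ dir)

    greedy-order : ∃ λ (es : List (Edge⁺ x d)) →
      Unique es × xx′ ∉ es × (∀ e → e ≢ xx′ → e ∈ es) × Conn (xx′ ∷ []) es
      × All (λ p → proj₂ p ≤ Δ) (greedy ((xx′ , i) ∷ []) es)
    greedy-order =
      order ,
      buckets-unique others-unique keyBound 0 ,
      xx′∉others ∘ proj₁ ∘ ∈-buckets⁻ keyBound 0 ,
      (λ e e≢xx′ → ∈-buckets⁺ keyBound 0 (∈-others e≢xx′) z≤n (key<keyBound e)) ,
      Prefixwise⇒Conn (xx′ ∷ []) order (in-order adjacent-earlier) ,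
      subst (λ c → All (λ p → proj₂ p ≤ Δ) (greedy ((xx′ , c) ∷ []) order)) colourOf-d
        (subst (All (λ p → proj₂ p ≤ Δ)) (sym greedy≡col) (colours-≤Δ (order ʳ++ xx′ ∷ [])))
      where
      in-order : ∀ {P} → (∀ {e} → e ∈ others → ∀ S → xx′ ∷ [] ⊆ S → Covers S (key e) → P S e) →
                 Prefixwise P (xx′ ∷ []) order
      in-order P-holds = buckets-prefixwise _ (xx′ ∷ []) P-holds keyBound 0 (xx′ ∷ []) (λ xx′∈ → xx′∈) (λ _ ())

      greedy≡col : greedy (coloured col (xx′ ∷ [])) order ≡ coloured col (order ʳ++ xx′ ∷ [])
      greedy≡col = greedy-reproduces col (λ _ → s≤s z≤n) col-proper (xx′ ∷ []) order
        (in-order sees-smaller-colours)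
        (Prefixwise-fresh (xx′ ∷ []) order (buckets-unique others-unique keyBound 0)
          λ { e∈ (here refl) → xx′∉others (proj₁ (∈-buckets⁻ keyBound 0 e∈)) })

lemma1 : (Δ : ℕ) → 3 ≤ Δ → (x : Cube Δ) (d : Fin Δ) →
    ((α : Edge⁺ x d → Fin Δ) → Proper α → α xx′ ≡ α yy′)
    × ((i : ℕ) → 1 ≤ i → i ≤ Δ →
         ∃ λ (es : List (Edge⁺ x d)) →
           Unique es × xx′ ∉ es × (∀ e → e ≢ xx′ → e ∈ es)
           × Conn (xx′ ∷ []) es
           × All (λ p → proj₂ p ≤ Δ) (greedy ((xx′ , i) ∷ []) es))
lemma1 Δ 3≤Δ x d = pendant-colours-agree x d , λ i 1≤i i≤Δ →
  let t , t+1≡i = colour-index i 1≤i i≤Δ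
      j₀ , j₀≢d = another-direction (ℕₚ.≤-trans (ℕₚ.n≤1+n 2) 3≤Δ) d
  in greedy-order x d i t t+1≡i j₀ j₀≢d
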